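{- For every rule set $\Sigma$, database $\mathcal{D}$ (such that $\Sigma$ and $\mathcal{D}$ have a core model) and normal Boolean conjunctive query $q$: if $\Sigma,\mathcal{D}\models_c q$, then $\mathcal{U}\models q$ for every universal model $\mathcal{U}$ of $\Sigma$ and $\mathcal{D}$.
   Context: Fix pairwise disjoint sets of constants, nulls, variables and predicates with arities. Atoms are $p(t_1,\ldots,t_{\mathrm{ar}(p)})$; an interpretation is a set of variable-free atoms; a database is a finite set of ground (constant-only) atoms. An existential rule is $\forall\vec x,\vec y.\,\varphi[\vec x,\vec y]\to\exists\vec z.\,\psi[\vec y,\vec z]$ (body/head conjunctions of atoms, frontier $\vec y$ occurring in the body); a rule set is a finite set of rules. Homomorphisms between sets of atoms fix constants and preserve atoms; an isomorphism is a bijective homomorphism whose inverse is also a homomorphism. A model of $\Sigma$ and $\mathcal{D}$ is an interpretation containing $\mathcal{D}$ in which every homomorphism from a rule body extends to one of the rule head; a model is universal if it maps homomorphically into every model. A finite interpretation is a core if every homomorphism from it to itself is an isomorphism; a core model is a finite universal model that is a core. A normal Boolean conjunctive query (BNCQ) is $q=\exists\vec x.\,\varphi\wedge\psi$ where $\varphi$ is a conjunction of atoms (set $q^+$) over $\vec x$ and constants and $\psi$ a conjunction of negated atoms $\neg p(\vec t)$ (set $q^-$ of the atoms $p(\vec t)$) using only variables occurring in $\varphi$; it is assumed non-trivial, i.e. $q^+\cap q^-=\emptyset$. An interpretation $I$ satisfies $q$ ($I\models q$) if there is a homomorphism $h:q^+\to I$ with $h(q^-)\cap I=\emptyset$. Core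 entailment: $\Sigma,\mathcal{D}\models_c q$ if $\Sigma$ and $\mathcal{D}$ have a core model satisfying $q$. -}

module Defs where

open import Level using (Level; 0ℓ) renaming (suc to lsuc)
open import Data.Nat using (ℕ)
open import Data.Product using (Σ; ∃; _×_; _,_; proj₁; proj₂)
open import Data.Vec using (Vec)
import Data.Vec as Vec
open import Data.Vec.Membership.Propositional renaming (_∈_ to _∈ᵥ_)
open import Data.List using (List)
open import Data.List.Membership.Propositional using (_∈_)
open import Relation.Binary.PropositionalEquality using (_≡_)
open import Relation.Nullary using (¬_)

-- A signature: a set of predicates with arities.
-- Constants, nulls and variables are each represented by ℕ (kept
-- disjoint by the constructors of the term types below).
record Signature : Set₁ where
  field
    Pred : Set
    ar   : Pred → ℕ

module _ (S : Signature) where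
  open Signature S

  Atom : Set → Set
  Atom T = Σ Pred (λ p → Vec T (ar p))

  mapAtom : {T U : Set} → (T → U) → Atom T → Atom U
  mapAtom f (p , ts) = (p , Vec.map f ts)

  _occursIn_ : {T : Set} → T → Atom T → Set
  t occursIn (p , ts) = t ∈ᵥ ts

  data GTerm : Set where
    const : ℕ → GTerm
    null  : ℕ → GTerm

  GAtom : Set
  GAtom = Atom GTerm

  Interp : Set₁
  Interp = GAtom → Set

  ⟦_⟧ : List GAtom → Interp
  ⟦ L ⟧ a = a ∈ L

  -- a database: finite set of ground atoms (arguments are constants)
  Database : Set
  Database = List (Atom ℕ)

  IsHom : (GTerm → GTerm) → Interp → Interp → Set
  IsHom h I J = (∀ c → h (const c) ≡ const c) × (∀ a → I a → J (mapAtom h a))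

  InDom : Interp → GTerm → Set
  InDom I t = ∃ λ a → I a × t occursIn a

  IsIso : (GTerm → GTerm) → Interp → Interp → Set
  IsIso h I J = IsHom h I J × ∃ λ g → IsHom g J I
    × (∀ t → InDom I t → InDom J (h t) × g (h t) ≡ t)
    × (∀ t → InDom J t → InDom I (g t) × h (g t) ≡ t)

  -- existential rule; variables (ℕ) are universally quantified if they
  -- occur in the body, existentially quantified otherwise
  record Rule : Set where
    field
      body : List (Atom ℕ)
      head : List (Atom ℕ)
  open Rule public

  RuleSet : Set
  RuleSet = List Rule

  VarIn : ℕ → List (Atom ℕ) → Set
  VarIn x as = ∃ λ a → a ∈ as × x occursIn a

  Satisfies : Interp → Rule → Set
  Satisfies I r = ∀ (h : ℕ → GTerm) → (∀ a → a ∈ body r → I (mapAtom h a)) →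
    ∃ λ (h' : ℕ → GTerm) → (∀ x → VarIn x (body r) → h' x ≡ h x)
      × (∀ a → a ∈ head r → I (mapAtom h' a))

  IsModel : RuleSet → Database → Interp → Set
  IsModel Σ D I = (∀ a → a ∈ D → I (mapAtom const a)) × (∀ r → r ∈ Σ → Satisfies I r)

  IsUniversalModel : RuleSet → Database → Interp → Set₁
  IsUniversalModel Σ D U =
    IsModel Σ D U × (∀ (M : Interp) → IsModel Σ D M → ∃ λ h → IsHom h U M)

  IsCore : List GAtom → Set
  IsCore C = ∀ h → IsHom h ⟦ C ⟧ ⟦ C ⟧ → IsIso h ⟦ C ⟧ ⟦ C ⟧

  IsCoreModel : RuleSet → Database → List GAtom → Set₁
  IsCoreModel Σ D C = IsUniversalModel Σ D ⟦ C ⟧ × IsCore C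

  data QTerm : Set where
    cst : ℕ → QTerm
    var : ℕ → QTerm

  record BNCQ : Set where
    field
      pos : List (Atom QTerm)
      neg : List (Atom QTerm)
  open BNCQ public

  WellFormed : BNCQ → Set
  WellFormed q =
    (∀ a → a ∈ neg q → ∀ x → var x occursIn a →
       ∃ λ b → b ∈ pos q × var x occursIn b)
    × (∀ a → a ∈ pos q → ¬ (a ∈ neg q))

  qmap : (ℕ → GTerm) → QTerm → GTerm
  qmap h (cst c) = const c
  qmap h (var x) = h x

  _⊨_ : Interp → BNCQ → Set
  I ⊨ q = ∃ λ (h : ℕ → GTerm) →
    (∀ a → a ∈ pos q → I (mapAtom (qmap h) a))
    × (∀ a → a ∈ neg q → ¬ I (mapAtom (qmap h) a))

  CoreEntails : RuleSet → Database → BNCQ → Set₁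
  CoreEntails Σ D q = ∃ λ C → IsCoreModel Σ D C × (⟦ C ⟧ ⊨ q)

-- The match of q in the core model C is pushed into U along a homomorphism
-- g : C → U. Positive atoms survive any homomorphism; for negative atoms we
-- need a way back: with f : U → C from universality of U, the endomorphism
-- f ∘ g of the core C is an isomorphism, so its inverse composed with f
-- retracts U onto C and pulls any offending atom of U back into C.
{-# OPTIONS --safe #-}
module Submission where

open import Defs
open import Data.Empty using (⊥)
open import Data.List using (List)
open import Data.List.Membership.Propositional using (_∈_)
open import Data.Nat using (ℕ)
open import Data.Product using (∃; _×_; _,_; proj₂)
open import Data.Vec using (Vec; []; _∷_)
import Data.Vec as Vec
open import Data.Vec.Properties using (map-∘)
open import Data.Vec.Membership.Propositional renaming (_∈_ to _∈ᵥ_)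
open import Data.Vec.Membership.Propositional.Properties using (∈-map⁺)
open import Data.Vec.Relation.Unary.Any using (here; there)
open import Function using (_∘_)
open import Relation.Binary.PropositionalEquality
  using (_≡_; refl; sym; trans; cong; cong₂; subst)

map-cong-∈ : ∀ {A B : Set} {n} {f g : A → B} (xs : Vec A n) →
  (∀ x → x ∈ᵥ xs → f x ≡ g x) → Vec.map f xs ≡ Vec.map g xs
map-cong-∈ []       _   = refl
map-cong-∈ (x ∷ xs) f≡g = cong₂ _∷_ (f≡g x (here refl)) (map-cong-∈ xs (λ y → f≡g y ∘ there))

module _ (S : Signature) where

  mapAtom-∘ : {T U V : Set} (f : U → V) (g : T → U) (a : Atom S T) →
    mapAtom S (f ∘ g) a ≡ mapAtom S f (mapAtom S g a)
  mapAtom-∘ f g (p , ts) = cong (p ,_) (map-∘ f g ts)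

  mapAtom-cong : {T U : Set} {f g : T → U} (a : Atom S T) →
    (∀ t → _occursIn_ S t a → f t ≡ g t) → mapAtom S f a ≡ mapAtom S g a
  mapAtom-cong (p , ts) f≡g = cong (p ,_) (map-cong-∈ ts f≡g)

  occursIn-mapAtom : {T U : Set} (f : T → U) {t : T} (a : Atom S T) →
    _occursIn_ S t a → _occursIn_ S (f t) (mapAtom S f a)
  occursIn-mapAtom f (p , ts) t∈ts = ∈-map⁺ f t∈ts

  IsHom-∘ : {I J K : Interp S} {f g : GTerm S → GTerm S} →
    IsHom S f J K → IsHom S g I J → IsHom S (f ∘ g) I K
  IsHom-∘ {K = K} {f} {g} (f-const , f-atom) (g-const , g-atom) =
    (λ c → trans (cong f (g-const c)) (f-const c)) ,
    (λ a Ia → subst K (sym (mapAtom-∘ f g a)) (f-atom _ (g-atom a Ia)))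

  qmap-∘ : (g : GTerm S → GTerm S) → (∀ c → g (const c) ≡ const c) →
    ∀ (h : ℕ → GTerm S) t → qmap S (g ∘ h) t ≡ g (qmap S h t)
  qmap-∘ g g-const h (cst c) = sym (g-const c)
  qmap-∘ g g-const h (var x) = refl

  IsRetract : Interp S → Interp S → (g r : GTerm S → GTerm S) → Set
  IsRetract I J g r =
    IsHom S g I J × IsHom S r J I × (∀ t → InDom S I t → r (g t) ≡ t)

  -- Safety of q is what puts every term of a negated atom in the domain of I,
  -- where r undoes g.
  ⊨-retract : {I J : Interp S} {g r : GTerm S → GTerm S} (q : BNCQ S) →
    WellFormed S q → IsRetract I J g r → _⊨_ S I q → _⊨_ S J q
  ⊨-retract {I} {J} {g} {r} q (safe , _)
    ((g-const , g-atom) , (r-const , r-atom) , r∘g≗id) (h , posI , negI) =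
    g ∘ h , posJ , negJ
    where
    pushed : ∀ a → mapAtom S (qmap S (g ∘ h)) a ≡ mapAtom S g (mapAtom S (qmap S h) a)
    pushed a =
      trans (mapAtom-cong a (λ t _ → qmap-∘ g g-const h t)) (mapAtom-∘ g (qmap S h) a)

    posJ : ∀ a → a ∈ pos q → J (mapAtom S (qmap S (g ∘ h)) a)
    posJ a a∈q⁺ = subst J (sym (pushed a)) (g-atom _ (posI a a∈q⁺))

    pulledBack : ∀ a → a ∈ neg q →
      mapAtom S r (mapAtom S (qmap S (g ∘ h)) a) ≡ mapAtom S (qmap S h) a
    pulledBack a a∈q⁻ = trans (sym (mapAtom-∘ r _ a)) (mapAtom-cong a fixed)
      where
      fixed : ∀ t → _occursIn_ S t a → r (qmap S (g ∘ h) t) ≡ qmap S h t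
      fixed (cst c) _ = r-const c
      fixed (var x) x∈a with safe a a∈q⁻ x x∈a
      ... | b , b∈q⁺ , x∈b =
        r∘g≗id (h x) (_ , posI b b∈q⁺ , occursIn-mapAtom (qmap S h) b x∈b)

    negJ : ∀ a → a ∈ neg q → J (mapAtom S (qmap S (g ∘ h)) a) → ⊥
    negJ a a∈q⁻ Ja = negI a a∈q⁻ (subst I (pulledBack a a∈q⁻) (r-atom _ Ja))

  core-retract : {C : List (GAtom S)} {J : Interp S} {g f : GTerm S → GTerm S} →
    IsCore S C → IsHom S g (⟦_⟧ S C) J → IsHom S f J (⟦_⟧ S C) →
    ∃ λ r → IsRetract (⟦_⟧ S C) J g r
  core-retract {C} {g = g} {f} core g-hom f-hom
    with core (f ∘ g) (IsHom-∘ {K = ⟦_⟧ S C} {f} {g} f-hom g-hom)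
  ... | _ , k , k-hom , k∘f∘g≗id , _ =
    k ∘ f , g-hom , IsHom-∘ {K = ⟦_⟧ S C} {k} {f} k-hom f-hom ,
    λ t t∈C → proj₂ (k∘f∘g≗id t t∈C)

theorem1 : (S : Signature) (Σ : RuleSet S) (D : Database S) (q : BNCQ S) →
    (∃ λ C → IsCoreModel S Σ D C) →
    WellFormed S q →
    CoreEntails S Σ D q →
    (U : Interp S) → IsUniversalModel S Σ D U → _⊨_ S U q
theorem1 S Σ D q _ wf (C , ((model-C , univ-C) , core) , C⊨q) U (model-U , univ-U) =
  let g , g-hom = univ-C U model-U
      f , f-hom = univ-U (⟦_⟧ S C) model-C
      _ , C◁U = core-retract S core g-hom f-hom
  in ⊨-retract S q wf C◁U C⊨q
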